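{- Let $n$ and $d_1,\ldots,d_k$ be positive integers. Then there exists a group automorphism $\phi$ of the group $\prod_{i=1}^k \mathbb{Z}_{n/\gcd(n,d_i)}$ such that \[ d_1h_1+\cdots+d_kh_k\equiv \gcd(n,d_1,\ldots,d_k)\pmod n, \] where $h_i$ is (any integer representative of) the $i$-th coordinate of $\phi(1,1,\ldots,1)$.
   Context: $\mathbb{Z}_r$ denotes the cyclic group of integers modulo $r$. Note $d_ih_i \bmod n$ does not depend on the representative chosen for $h_i\in\mathbb{Z}_{n/\gcd(n,d_i)}$. -}

module Defs where

open import Data.Nat as ℕ using (ℕ; NonZero; ≢-nonZero; ≢-nonZero⁻¹)
open import Data.Nat.GCD using (gcd; gcd[m,n]≢0)
open import Data.Nat.DivMod using (_/_)
open import Data.Integer as ℤ using (ℤ; +_; _-_)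
open import Data.Integer.Divisibility renaming (_∣_ to _∣ℤ_)
open import Data.Fin using (Fin)
open import Data.Vec.Functional using (Vector; foldr)
open import Data.Product using (Σ; Σ-syntax)
open import Data.Sum using (inj₁)

gcdNZ : (n d : ℕ) → .{{_ : NonZero n}} → NonZero (gcd n d)
gcdNZ n d = ≢-nonZero (gcd[m,n]≢0 n d (inj₁ (≢-nonZero⁻¹ n)))

order : (n d : ℕ) → .{{_ : NonZero n}} → ℕ
order n d = _/_ n (gcd n d) {{gcdNZ n d}}

-- The group ∏_{i} ℤ_{m i}: elements are integer tuples (representatives),
-- equality is coordinatewise congruence modulo m i, operation is
-- coordinatewise addition.  (A setoid presentation of the quotient.)
module ProductGroup {k : ℕ} (m : Fin k → ℕ) where

  Elem : Set
  Elem = Vector ℤ k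

  _≈_ : Elem → Elem → Set
  x ≈ y = ∀ i → (+ m i) ∣ℤ (x i - y i)

  _⊕_ : Elem → Elem → Elem
  (x ⊕ y) i = x i ℤ.+ y i

  record IsAutomorphism (φ : Elem → Elem) : Set where
    field
      cong       : ∀ x y → x ≈ y → φ x ≈ φ y
      homo       : ∀ x y → φ (x ⊕ y) ≈ (φ x ⊕ φ y)
      injective  : ∀ x y → φ x ≈ φ y → x ≈ y
      surjective : ∀ y → Σ[ x ∈ Elem ] (φ x ≈ y)

open ProductGroup public using (IsAutomorphism)

gcdAll : (n : ℕ) {k : ℕ} → Vector ℕ k → ℕ
gcdAll n d = foldr gcd n d

weightedSum : {k : ℕ} → Vector ℕ k → Vector ℤ k → ℤ
weightedSum d h = foldr ℤ._+_ (+ 0) (λ i → (+ d i) ℤ.* h i)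

module Submission where

-- Write mᵢ = n / gcd(n, dᵢ), G = gcd(n, d₁, …, d_k) and 1 = (1, …, 1).
--
-- Suppose φ' is an automorphism of
-- ∏_{i ≥ 2} ℤ_{mᵢ} with b = φ'(1) satisfying Σ_{i ≥ 2} dᵢbᵢ ≡ G' (mod n),
-- where G' = gcd(n, d₂, …, d_k), and write n = P·G'; every mᵢ (i ≥ 2)
-- divides P.  The automorphism for k coordinates is the composite
--   x ↦ (x₁, φ'(x₂, …))                  (extension by the identity)
--     ↦ (u·x₁, v·x₂, …, v·x_k)             (scaling by units)
--     ↦ (x₁, x₂ + c·x₁·b₂, …)              (a transvection, P ∣ c·m₁)
-- which sends 1 to (u, (v + cu)·b), so Σ dᵢhᵢ ≡ d₁u + (v + cu)·G' (mod n).
-- The number-theoretic heart (merge-coefficients) chooses u, v, c with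
-- this quantity ≡ gcd(d₁, G') (mod n); it rests on the lifting of units
-- (unit-lift): if a is coprime to b, some a + b·t is coprime to any M ≠ 0.

open import Defs

open import Level using (0ℓ)
open import Data.Nat as ℕ using (ℕ; zero; suc; NonZero; NonTrivial; _<_)
import Data.Nat.Properties as ℕ
import Data.Nat.Divisibility as ℕ
open import Data.Nat.DivMod using (m/n*n≡m)
open import Data.Nat.GCD
  using (gcd; gcd[m,n]∣m; gcd[m,n]∣n; gcd[m,n]≢0; gcd-greatest; m/gcd[m,n]≢0; module Bézout)
open import Data.Nat.Coprimality using (Coprime; gcd≡1⇒coprime; coprime-Bézout; coprime-/gcd)
open import Data.Nat.Induction using (<-wellFounded)
open import Induction.WellFounded using (Acc; acc)
open import Data.Integer as ℤ using (ℤ; +_; -_; _+_; _*_; _-_; _^_; 0ℤ; 1ℤ; -1ℤ; ∣_∣)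
import Data.Integer.Properties as ℤ
open import Data.Integer.Divisibility using () renaming (_∣_ to _∣ᵤ_)
open import Data.Integer.Divisibility.Signed
  using (_∣_; divides; ∣⇒∣ᵤ; ∣ᵤ⇒∣; ∣-refl; ∣-trans; ∣m∣n⇒∣m+n; ∣m⇒∣-m; ∣n⇒∣m*n; ∣m⇒∣m*n;
         *-monoʳ-∣; *-monoˡ-∣; *-cancelʳ-∣)
open import Data.Integer.Tactic.RingSolver using (solve-∀)
open import Data.Fin using (Fin; zero; suc)
open import Data.Vec.Functional using (Vector; tail)
open import Data.Product using (Σ; Σ-syntax; _×_; _,_; proj₁; proj₂)
open import Data.Sum using (inj₁; inj₂)
open import Data.Empty using (⊥-elim)
open import Function using (_∘_)
open import Relation.Binary.Bundles using (Setoid)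
open import Relation.Binary.PropositionalEquality
open import Relation.Nullary using (yes; no)
import Relation.Binary.Reasoning.Setoid as SetoidReasoning

infix 4 _≡[_]_
record _≡[_]_ (a m b : ℤ) : Set where
  constructor mod-intro
  field mod-elim : m ∣ a - b
open _≡[_]_ public

mod-transport : ∀ {a a' m m' b b'} → a ≡ a' → m ≡ m' → b ≡ b' → a ≡[ m ] b → a' ≡[ m' ] b'
mod-transport refl refl refl a≡b = a≡b

module _ {m : ℤ} where

  mod-reflexive : ∀ {a b} → a ≡ b → a ≡[ m ] b
  mod-reflexive {a} refl = mod-intro (divides 0ℤ (ℤ.+-inverseʳ a))

  mod-refl : ∀ {a} → a ≡[ m ] a
  mod-refl = mod-reflexive refl

  mod-sym : ∀ {a b} → a ≡[ m ] b → b ≡[ m ] a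
  mod-sym {a} {b} a≡b = mod-intro (subst (m ∣_) (flip a b) (∣m⇒∣-m (mod-elim a≡b)))
    where
    flip : ∀ a b → - (a - b) ≡ b - a
    flip = solve-∀

  mod-trans : ∀ {a b c} → a ≡[ m ] b → b ≡[ m ] c → a ≡[ m ] c
  mod-trans {a} {b} {c} a≡b b≡c =
    mod-intro (subst (m ∣_) (telescope a b c) (∣m∣n⇒∣m+n (mod-elim a≡b) (mod-elim b≡c)))
    where
    telescope : ∀ a b c → (a - b) + (b - c) ≡ a - c
    telescope = solve-∀

  mod-+ : ∀ {a b c d} → a ≡[ m ] b → c ≡[ m ] d → a + c ≡[ m ] b + d
  mod-+ {a} {b} {c} {d} a≡b c≡d =
    mod-intro (subst (m ∣_) (regroup a b c d) (∣m∣n⇒∣m+n (mod-elim a≡b) (mod-elim c≡d)))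
    where
    regroup : ∀ a b c d → (a - b) + (c - d) ≡ (a + c) - (b + d)
    regroup = solve-∀

  mod-* : ∀ {a b c d} → a ≡[ m ] b → c ≡[ m ] d → a * c ≡[ m ] b * d
  mod-* {a} {b} {c} {d} a≡b c≡d =
    mod-intro (subst (m ∣_) (regroup a b c d)
      (∣m∣n⇒∣m+n (∣n⇒∣m*n a (mod-elim c≡d)) (∣m⇒∣m*n d (mod-elim a≡b))))
    where
    regroup : ∀ a b c d → a * (c - d) + (a - b) * d ≡ a * c - b * d
    regroup = solve-∀

  mod-weaken : ∀ {k a b} → k ∣ m → a ≡[ m ] b → a ≡[ k ] b
  mod-weaken k∣m a≡b = mod-intro (∣-trans k∣m (mod-elim a≡b))

  mod-scale : ∀ k {a b} → a ≡[ m ] b → k * a ≡[ k * m ] k * b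
  mod-scale k {a} {b} a≡b = mod-intro (subst (k * m ∣_) (distrib k a b) (*-monoʳ-∣ k (mod-elim a≡b)))
    where
    distrib : ∀ k a b → k * (a - b) ≡ k * a - k * b
    distrib = solve-∀

mod-setoid : ℤ → Setoid 0ℓ 0ℓ
mod-setoid m = record
  { Carrier       = ℤ
  ; _≈_           = λ a b → a ≡[ m ] b
  ; isEquivalence = record { refl = mod-refl ; sym = mod-sym ; trans = mod-trans }
  }

module mod-Reasoning (m : ℤ) = SetoidReasoning (mod-setoid m)

-- a and b are comaximal when α·a + β·b = 1 for some integers α, β; this
-- is coprimality in a form that can be computed with.
record Comaximal (a b : ℤ) : Set where
  constructor comaximal
  field
    α β      : ℤ
    identity : α * a + β * b ≡ 1ℤ

comaximal-sym : ∀ {a b} → Comaximal a b → Comaximal b a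
comaximal-sym {a} {b} (comaximal α β eq) = comaximal β α (trans (ℤ.+-comm (β * b) (α * a)) eq)

comaximal⇒inverse : ∀ {a m} (am : Comaximal a m) → a * Comaximal.α am ≡[ m ] 1ℤ
comaximal⇒inverse {a} {m} (comaximal α β eq) =
  mod-intro (divides (- β) (trans (cong (λ z → a * α - z) (sym eq)) (rearrange a m α β)))
  where
  rearrange : ∀ a m α β → a * α - (α * a + β * m) ≡ (- β) * m
  rearrange = solve-∀

comaximal-mod : ∀ {a a' b} → a ≡[ b ] a' → Comaximal a b → Comaximal a' b
comaximal-mod {a} {a'} {b} a≡a' (comaximal α β eq) with mod-elim a≡a'
... | divides q a-a'≡qb = comaximal α (β + α * q) (begin
  α * a' + (β + α * q) * b  ≡⟨ expand α β a' q b ⟩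
  α * (a' + q * b) + β * b  ≡⟨ cong (λ z → α * (a' + z) + β * b) a-a'≡qb ⟨
  α * (a' + (a - a')) + β * b ≡⟨ cancel α β a a' b ⟩
  α * a + β * b             ≡⟨ eq ⟩
  1ℤ                        ∎)
  where
  open ≡-Reasoning
  expand : ∀ α β a' q b → α * a' + (β + α * q) * b ≡ α * (a' + q * b) + β * b
  expand = solve-∀
  cancel : ∀ α β a a' b → α * (a' + (a - a')) + β * b ≡ α * a + β * b
  cancel = solve-∀

comaximal-* : ∀ {a b c} → Comaximal a b → Comaximal a c → Comaximal a (b * c)
comaximal-* {a} {b} {c} (comaximal α β eq) (comaximal α' β' eq') =
  comaximal (α * α' * a + α * β' * c + β * b * α') (β * β')
    (trans (product a b c α β α' β') (cong₂ _*_ eq eq'))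
  where
  product : ∀ a b c α β α' β' →
    (α * α' * a + α * β' * c + β * b * α') * a + (β * β') * (b * c)
      ≡ (α * a + β * b) * (α' * a + β' * c)
  product = solve-∀

comaximal-^ : ∀ {a b} j → Comaximal a b → Comaximal a (b ^ j)
comaximal-^ zero    _  = comaximal 0ℤ 1ℤ refl
comaximal-^ (suc j) ab = comaximal-* ab (comaximal-^ j ab)

comaximal-divisor : ∀ {a b c} → c ∣ b → Comaximal a b → Comaximal a c
comaximal-divisor {a} {c = c} (divides q refl) (comaximal α β eq) =
  comaximal α (β * q) (trans (cong (λ z → α * a + z) (ℤ.*-assoc β q c)) eq)

comaximal-abs : ∀ {a b} → Comaximal (+ ∣ a ∣) b → Comaximal a b
comaximal-abs {a} {b} ab with ℤ.+∣i∣≡i⊎+∣i∣≡-i a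
... | inj₁ |a|≡a  = subst (λ z → Comaximal z b) |a|≡a ab
... | inj₂ |a|≡-a with subst (λ z → Comaximal z b) |a|≡-a ab
...   | comaximal α β eq = comaximal (- α) β (trans (cong (_+ β * b) (negate α a)) eq)
  where
  negate : ∀ α a → (- α) * a ≡ α * (- a)
  negate α a = trans (sym (ℤ.neg-distribˡ-* α a)) (ℤ.neg-distribʳ-* α a)

bézout-in-ℤ : ∀ x a y b → 1 ℕ.+ y ℕ.* b ≡ x ℕ.* a → + x * + a + (- + y) * + b ≡ 1ℤ
bézout-in-ℤ x a y b eq = begin
  + x * + a + (- + y) * + b             ≡⟨ cong (_+ (- + y) * + b) lift-eq ⟨
  (1ℤ + + y * + b) + (- + y) * + b      ≡⟨ cancel (+ y) (+ b) ⟩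
  1ℤ                                    ∎
  where
  open ≡-Reasoning
  lift-eq : 1ℤ + + y * + b ≡ + x * + a
  lift-eq = trans (cong (λ z → 1ℤ + z) (sym (ℤ.pos-* y b))) (trans (cong +_ eq) (ℤ.pos-* x a))
  cancel : ∀ y b → (1ℤ + y * b) + (- y) * b ≡ 1ℤ
  cancel = solve-∀

coprime⇒comaximal : ∀ {a b} → Coprime a b → Comaximal (+ a) (+ b)
coprime⇒comaximal {a} {b} a⊥b with coprime-Bézout a⊥b
... | Bézout.+- x y eq = comaximal (+ x) (- + y) (bézout-in-ℤ x a y b eq)
... | Bézout.-+ x y eq = comaximal-sym (comaximal (+ y) (- + x) (bézout-in-ℤ y b x a eq))

-- A coprime part of K with respect to x: K divides K'·xʲ with K' coprime
-- to x, i.e. apart from primes dividing x, K is coprime to x.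
record CoprimePart (x : ℤ) (K : ℕ) : Set where
  constructor coprime-part-of
  field
    K' j      : ℕ
    coprime   : Comaximal x (+ K')
    covers    : + K ∣ + K' * x ^ j

-- Every K ≠ 0 has a coprime part.  (Strong induction on K: if
-- c = gcd(K, |x|) > 1, take a coprime part of K / c.)
coprime-part : (x : ℤ) (K : ℕ) .{{_ : NonZero K}} → CoprimePart x K
coprime-part x K = strip K (<-wellFounded K)
  where
  strip : (K : ℕ) .{{_ : NonZero K}} → Acc _<_ K → CoprimePart x K
  strip K (acc smaller) with gcd K ∣ x ∣ ℕ.≟ 1
  ... | yes c≡1 = coprime-part-of K 0
                    (comaximal-abs (comaximal-sym (coprime⇒comaximal (gcd≡1⇒coprime c≡1))))
                    (∣m⇒∣m*n (x ^ 0) ∣-refl)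
  ... | no  c≢1 = absorb (strip q (smaller (ℕ.quotient-< c∣K)))
    where
    -- c = gcd(K, |x|) > 1 and K = q·c; the factor c is absorbed by one more power of x
    c : ℕ
    c = gcd K ∣ x ∣
    c∣K : c ℕ.∣ K
    c∣K = gcd[m,n]∣m K ∣ x ∣
    q : ℕ
    q = ℕ.quotient c∣K
    instance
      c-nonZero : NonZero c
      c-nonZero = ℕ.≢-nonZero (gcd[m,n]≢0 K ∣ x ∣ (inj₁ (ℕ.≢-nonZero⁻¹ K)))
      c-nonTrivial : NonTrivial c
      c-nonTrivial = nonTrivial c c≢1
        where
        nonTrivial : ∀ c .{{_ : NonZero c}} → c ≢ 1 → NonTrivial c
        nonTrivial (suc zero)    c≢1 = ⊥-elim (c≢1 refl)
        nonTrivial (suc (suc _)) _   = _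
      q-nonZero : NonZero q
      q-nonZero = ℕ.quotient≢0 c∣K
    K≡qc : + K ≡ + q * + c
    K≡qc = trans (cong +_ (ℕ.m∣n⇒n≡quotient*m c∣K)) (ℤ.pos-* q c)
    c∣x : + c ∣ x
    c∣x = ∣ᵤ⇒∣ (gcd[m,n]∣n K ∣ x ∣)
    absorb : CoprimePart x q → CoprimePart x K
    absorb (coprime-part-of K' j xK' q∣K'xʲ) = coprime-part-of K' (suc j) xK'
      (subst₂ _∣_ (sym K≡qc) (reassociate (+ K') x (x ^ j))
        (∣-trans (*-monoˡ-∣ (+ c) q∣K'xʲ) (*-monoʳ-∣ (+ K' * x ^ j) c∣x)))
      where
      reassociate : ∀ k x y → k * y * x ≡ k * (x * y)
      reassociate = solve-∀

-- With M ∣ K'·aʲ and K' coprime to a,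
-- the choice t = K' works: a + b·K' is ≡ a (mod K') and ≡ b·K' (mod a).
unit-lift : (a b : ℤ) (M : ℕ) .{{_ : NonZero M}} → Comaximal a b →
  Σ ℤ λ t → Comaximal (a + b * t) (+ M)
unit-lift a b M ab with coprime-part a M
... | coprime-part-of K' j aK' M∣K'aʲ =
  + K' , comaximal-divisor M∣K'aʲ (comaximal-* uK' (comaximal-^ j ua))
  where
  uK' : Comaximal (a + b * + K') (+ K')
  uK' = comaximal-mod (mod-intro (divides (- b) (mod-K' a b (+ K')))) aK'
    where
    mod-K' : ∀ a b k → a - (a + b * k) ≡ (- b) * k
    mod-K' = solve-∀
  ua : Comaximal (a + b * + K') a
  ua = comaximal-mod (mod-intro (divides -1ℤ (mod-a a b (+ K')))) (comaximal-sym (comaximal-* ab aK'))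
    where
    mod-a : ∀ a b k → b * k - (a + b * k) ≡ -1ℤ * a
    mod-a = solve-∀

module _ {n : ℕ} .{{_ : NonZero n}} where

  order*gcd : ∀ d → order n d ℕ.* gcd n d ≡ n
  order*gcd d = m/n*n≡m {{gcdNZ n d}} (gcd[m,n]∣m n d)

  order-nonZero : ∀ d → NonZero (order n d)
  order-nonZero d = ℕ.≢-nonZero (m/gcd[m,n]≢0 n d {{gcd≢0 = gcdNZ n d}})

  factors-nonZero : ∀ {a b} → n ≡ a ℕ.* b → NonZero a × NonZero b
  factors-nonZero {a} {b} n≡ab = ℕ.m*n≢0⇒m≢0 a , ℕ.m*n≢0⇒n≢0 a
    where
    instance
      ab-nonZero : NonZero (a ℕ.* b)
      ab-nonZero = ℕ.≢-nonZero (λ ab≡0 → ℕ.≢-nonZero⁻¹ n (trans n≡ab ab≡0))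

  -- d·mᵢ is a multiple of n, i.e. x ↦ d·x is well defined on ℤ_{order n d}
  n∣d*order : ∀ d → n ℕ.∣ d ℕ.* order n d
  n∣d*order d with gcd[m,n]∣n n d
  ... | ℕ.divides D d≡Dg = ℕ.divides D (begin
    d ℕ.* order n d              ≡⟨ cong (ℕ._* order n d) d≡Dg ⟩
    D ℕ.* gcd n d ℕ.* order n d  ≡⟨ ℕ.*-assoc D (gcd n d) (order n d) ⟩
    D ℕ.* (gcd n d ℕ.* order n d) ≡⟨ cong (D ℕ.*_) (ℕ.*-comm (gcd n d) (order n d)) ⟩
    D ℕ.* (order n d ℕ.* gcd n d) ≡⟨ cong (D ℕ.*_) (order*gcd d) ⟩
    D ℕ.* n                      ∎)
    where open ≡-Reasoning

  order∣cofactor : ∀ {d P G} → n ≡ P ℕ.* G → G ℕ.∣ d → order n d ℕ.∣ P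
  order∣cofactor {d} {P} {G} n≡PG G∣d =
    ℕ.*-cancelʳ-∣ G (subst (order n d ℕ.* G ℕ.∣_) (trans (order*gcd d) n≡PG)
                      (ℕ.*-monoʳ-∣ (order n d) (gcd-greatest (ℕ.divides P n≡PG) G∣d)))
    where
    instance
      G-nonZero : NonZero G
      G-nonZero = proj₂ (factors-nonZero {P} n≡PG)

-- In the induction step these become the scaling by (u, v, …, v)
-- and the transvection by c.
record Merge (a b m₀ P N g : ℤ) : Set where
  field
    u v c    : ℤ
    u-unit   : Comaximal u m₀
    v-unit   : Comaximal v P
    c-admits : P ∣ c * m₀
    merges   : a * u + (v + c * u) * b ≡[ N ] g

-- Write
-- p·A + q·B = 1 and lift p to a unit u = p + B·t₁ modulo m₀; then
-- x₂ = q − A·t₁ satisfies A·u + B·x₂ = 1, and we lift x₂ to a unit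
-- v = x₂ + A·t₂ modulo P.  With u·ū ≡ 1 (mod m₀) put c = −t₂·ū·A; as
-- P ∣ A·m₀ we get v + c·u ≡ x₂ (mod P), so A·u + (v + c·u)·B ≡ 1 (mod B·P).
coprime-merge : (A B P m₀ : ℕ) .{{_ : NonZero P}} .{{_ : NonZero m₀}} →
  Comaximal (+ A) (+ B) → + P ∣ + A * + m₀ → Merge (+ A) (+ B) (+ m₀) (+ P) (+ B * + P) 1ℤ
coprime-merge A B P m₀ (comaximal p q pA+qB≡1) P∣Am₀ = record
  { u = u ; v = v ; c = c ; u-unit = u-unit ; v-unit = v-unit ; c-admits = c-admits ; merges = merges }
  where
  lift₁ : Σ ℤ λ t → Comaximal (p + + B * t) (+ m₀)
  lift₁ = unit-lift p (+ B) m₀ (comaximal (+ A) q (trans (cong (_+ q * + B) (ℤ.*-comm (+ A) p)) pA+qB≡1))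
  t₁ u : ℤ
  t₁ = proj₁ lift₁
  u  = p + + B * t₁
  u-unit : Comaximal u (+ m₀)
  u-unit = proj₂ lift₁

  x₂ : ℤ
  x₂ = q - + A * t₁
  Au+Bx₂≡1 : + A * u + x₂ * + B ≡ 1ℤ
  Au+Bx₂≡1 = trans (expand p q (+ A) (+ B) t₁) pA+qB≡1
    where
    expand : ∀ p q a b t → a * (p + b * t) + (q - a * t) * b ≡ p * a + q * b
    expand = solve-∀

  lift₂ : Σ ℤ λ t → Comaximal (x₂ + + A * t) (+ P)
  lift₂ = unit-lift x₂ (+ A) P (comaximal (+ B) u (trans (swap (+ A) (+ B) u x₂) Au+Bx₂≡1))
    where
    swap : ∀ a b u x → b * x + u * a ≡ a * u + x * b
    swap = solve-∀
  t₂ v : ℤ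
  t₂ = proj₁ lift₂
  v  = x₂ + + A * t₂
  v-unit : Comaximal v (+ P)
  v-unit = proj₂ lift₂

  ū c : ℤ
  ū = Comaximal.α u-unit
  c = - (t₂ * ū) * + A

  c-admits : + P ∣ c * + m₀
  c-admits = subst (+ P ∣_) (sym (ℤ.*-assoc (- (t₂ * ū)) (+ A) (+ m₀))) (∣n⇒∣m*n (- (t₂ * ū)) P∣Am₀)

  v+cu≡x₂ : v + c * u ≡[ + P ] x₂
  v+cu≡x₂ = begin
    v + c * u                                ≡⟨ expand x₂ (+ A) t₂ ū u ⟩
    x₂ + + A * t₂ + (- t₂) * (+ A * (u * ū))
      ≈⟨ mod-+ (mod-refl {a = x₂ + + A * t₂}) (mod-* (mod-refl {a = - t₂}) Auū≡A) ⟩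
    x₂ + + A * t₂ + (- t₂) * (+ A * 1ℤ)      ≡⟨ cancel x₂ (+ A) t₂ ⟩
    x₂                                       ∎
    where
    open mod-Reasoning (+ P)
    Auū≡A : + A * (u * ū) ≡[ + P ] + A * 1ℤ
    Auū≡A = mod-weaken P∣Am₀ (mod-scale (+ A) (comaximal⇒inverse u-unit))
    expand : ∀ x a t ū u → (x + a * t) + (- (t * ū) * a) * u ≡ x + a * t + (- t) * (a * (u * ū))
    expand = solve-∀
    cancel : ∀ x a t → x + a * t + (- t) * (a * 1ℤ) ≡ x
    cancel = solve-∀

  merges : + A * u + (v + c * u) * + B ≡[ + B * + P ] 1ℤ
  merges = mod-trans (mod-+ (mod-refl {a = + A * u}) (mod-transport (ℤ.*-comm (+ B) (v + c * u)) refl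
                                                        (ℤ.*-comm (+ B) x₂) (mod-scale (+ B) v+cu≡x₂)))
                     (mod-reflexive Au+Bx₂≡1)

merge-scale : ∀ {a b m₀ P N g a' b' N' g'} e →
  a' ≡ a * e → b' ≡ b * e → N' ≡ N * e → g' ≡ g * e →
  Merge a b m₀ P N g → Merge a' b' m₀ P N' g'
merge-scale {a} {b} {N = N} {g} e refl refl refl refl M = record
  { u = u ; v = v ; c = c ; u-unit = u-unit ; v-unit = v-unit ; c-admits = c-admits
  ; merges   = mod-transport (regroup a b e u (v + c * u)) (ℤ.*-comm e N) (ℤ.*-comm e g)
                             (mod-scale e merges)
  }
  where
  open Merge M
  regroup : ∀ a b e u k → e * (a * u + k * b) ≡ a * e * u + k * (b * e)
  regroup = solve-∀

-- With e = gcd(d, G), d = A·e and G = B·e, the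
-- quotients A and B are coprime and P ∣ A·m₀ (cancel e from n ∣ d·m₀), so
-- this is the coprime merge scaled by e.
merge-coefficients : (n : ℕ) .{{_ : NonZero n}} (d G P : ℕ) → n ≡ P ℕ.* G →
  Merge (+ d) (+ G) (+ order n d) (+ P) (+ n) (+ gcd d G)
merge-coefficients n d G P n≡PG =
  merge-scale (+ e) d≡Ae G≡Be n≡BPe (sym (ℤ.*-identityˡ (+ e)))
    (coprime-merge A B P m₀ (coprime⇒comaximal (coprime-/gcd d G)) P∣Am₀)
  where
  m₀ e : ℕ
  m₀ = order n d
  e  = gcd d G
  instance
    P-nonZero : NonZero P
    P-nonZero = proj₁ (factors-nonZero n≡PG)
    G-nonZero : NonZero G
    G-nonZero = proj₂ (factors-nonZero {a = P} n≡PG)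
    e-nonZero : NonZero e
    e-nonZero = ℕ.≢-nonZero (gcd[m,n]≢0 d G (inj₂ (ℕ.≢-nonZero⁻¹ G)))
    m₀-nonZero : NonZero m₀
    m₀-nonZero = order-nonZero d

  A B : ℕ
  A = d ℕ./ e
  B = G ℕ./ e
  d≡Ae : + d ≡ + A * + e
  d≡Ae = trans (cong +_ (sym (m/n*n≡m (gcd[m,n]∣m d G)))) (ℤ.pos-* A e)
  G≡Be : + G ≡ + B * + e
  G≡Be = trans (cong +_ (sym (m/n*n≡m (gcd[m,n]∣n d G)))) (ℤ.pos-* B e)
  n≡BPe : + n ≡ (+ B * + P) * + e
  n≡BPe = trans (cong +_ n≡PG)
            (trans (ℤ.pos-* P G) (trans (cong (+ P *_) G≡Be) (swap (+ P) (+ B) (+ e))))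
    where
    swap : ∀ p b e → p * (b * e) ≡ (b * p) * e
    swap = solve-∀

  P∣Am₀ : + P ∣ + A * + m₀
  P∣Am₀ = ∣-trans (∣n⇒∣m*n (+ B) ∣-refl) (*-cancelʳ-∣ (+ e) (subst₂ _∣_ n≡BPe dm₀≡Am₀e n∣dm₀))
    where
    n∣dm₀ : + n ∣ + d * + m₀
    n∣dm₀ = subst (+ n ∣_) (ℤ.pos-* d m₀) (∣ᵤ⇒∣ (n∣d*order d))
    dm₀≡Am₀e : + d * + m₀ ≡ + A * + m₀ * + e
    dm₀≡Am₀e = trans (cong (_* + m₀) d≡Ae) (swap (+ A) (+ e) (+ m₀))
      where
      swap : ∀ a e m → a * e * m ≡ a * m * e
      swap = solve-∀

module Automorphisms {k : ℕ} (m : Fin k → ℕ) where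
  open ProductGroup m using (Elem; _≈_; _⊕_)

  -- coordinatewise congruence: ProductGroup._≈_ expressed through the
  -- congruence record, which lets Agda infer the compared elements
  infix 4 _≋_
  _≋_ : Elem → Elem → Set
  x ≋ y = ∀ i → x i ≡[ + m i ] y i

  ≋⇒≈ : ∀ {x y} → x ≋ y → x ≈ y
  ≋⇒≈ x≋y i = ∣⇒∣ᵤ (mod-elim (x≋y i))

  ≈⇒≋ : ∀ {x y} → x ≈ y → x ≋ y
  ≈⇒≋ x≈y i = mod-intro (∣ᵤ⇒∣ (x≈y i))

  ≋-reflexive : ∀ {x y} → (∀ i → x i ≡ y i) → x ≋ y
  ≋-reflexive x≡y i = mod-reflexive (x≡y i)

  ≋-refl : ∀ {x} → x ≋ x
  ≋-refl i = mod-refl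

  ≋-sym : ∀ {x y} → x ≋ y → y ≋ x
  ≋-sym x≋y i = mod-sym (x≋y i)

  ≋-trans : ∀ {x y z} → x ≋ y → y ≋ z → x ≋ z
  ≋-trans x≋y y≋z i = mod-trans (x≋y i) (y≋z i)

  record Invertible (φ : Elem → Elem) : Set where
    field
      inverse           : Elem → Elem
      congruent         : ∀ {x y} → x ≋ y → φ x ≋ φ y
      inverse-congruent : ∀ {x y} → x ≋ y → inverse x ≋ inverse y
      additive          : ∀ x y → φ (x ⊕ y) ≋ φ x ⊕ φ y
      right-inverse     : ∀ x → φ (inverse x) ≋ x
      left-inverse      : ∀ x → inverse (φ x) ≋ x

  invertible⇒automorphism : ∀ {φ} → Invertible φ → IsAutomorphism m φ
  invertible⇒automorphism {φ} I = record
    { cong       = λ x y x≈y → ≋⇒≈ (congruent {x} {y} (≈⇒≋ x≈y))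
    ; homo       = λ x y → ≋⇒≈ (additive x y)
    ; injective  = λ x y φx≈φy → ≋⇒≈ (≋-trans (≋-sym (left-inverse x))
                     (≋-trans (inverse-congruent {φ x} {φ y} (≈⇒≋ φx≈φy)) (left-inverse y)))
    ; surjective = λ y → inverse y , ≋⇒≈ (right-inverse y)
    }
    where open Invertible I

  id-invertible : Invertible (λ x → x)
  id-invertible = record
    { inverse = λ x → x ; congruent = λ x≋y → x≋y ; inverse-congruent = λ x≋y → x≋y
    ; additive = λ _ _ → ≋-refl ; right-inverse = λ _ → ≋-refl ; left-inverse = λ _ → ≋-refl }

  ∘-invertible : ∀ {φ χ} → Invertible φ → Invertible χ → Invertible (χ ∘ φ)
  ∘-invertible {φ} {χ} I J = record
    { inverse           = I.inverse ∘ J.inverse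
    ; congruent         = J.congruent ∘ I.congruent
    ; inverse-congruent = I.inverse-congruent ∘ J.inverse-congruent
    ; additive          = λ x y → ≋-trans (J.congruent (I.additive x y)) (J.additive (φ x) (φ y))
    ; right-inverse     = λ x → ≋-trans (J.congruent (I.right-inverse (J.inverse x))) (J.right-inverse x)
    ; left-inverse      = λ x → ≋-trans (I.inverse-congruent (J.left-inverse (φ x))) (I.left-inverse x)
    }
    where
    module I = Invertible I
    module J = Invertible J

  scale : Vector ℤ k → Elem → Elem
  scale s x i = s i * x i

  scale-cong : ∀ s {x y} → x ≋ y → scale s x ≋ scale s y
  scale-cong s x≋y i = mod-* (mod-refl {a = s i}) (x≋y i)

  scale-inverse : ∀ s s' → (∀ i → s i * s' i ≡[ + m i ] 1ℤ) → ∀ x → scale s' (scale s x) ≋ x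
  scale-inverse s s' ss'≡1 x i = begin
    s' i * (s i * x i)   ≡⟨ regroup (s i) (s' i) (x i) ⟩
    (s i * s' i) * x i   ≈⟨ mod-* (ss'≡1 i) mod-refl ⟩
    1ℤ * x i             ≡⟨ ℤ.*-identityˡ (x i) ⟩
    x i                  ∎
    where
    open mod-Reasoning (+ m i)
    regroup : ∀ s s' x → s' * (s * x) ≡ (s * s') * x
    regroup = solve-∀

  scale-invertible : ∀ s → (∀ i → Comaximal (s i) (+ m i)) → Invertible (scale s)
  scale-invertible s units = record
    { inverse           = scale s'
    ; congruent         = scale-cong s
    ; inverse-congruent = scale-cong s'
    ; additive          = λ x y → ≋-reflexive (λ i → ℤ.*-distribˡ-+ (s i) (x i) (y i))
    ; right-inverse     = scale-inverse s' s
                            (λ i → mod-trans (mod-reflexive (ℤ.*-comm (s' i) (s i))) (ss'≡1 i))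
    ; left-inverse      = scale-inverse s s' ss'≡1
    }
    where
    s' : Vector ℤ k
    s' i = Comaximal.α (units i)
    ss'≡1 : ∀ i → s i * s' i ≡[ + m i ] 1ℤ
    ss'≡1 i = comaximal⇒inverse (units i)

module Extensions {k : ℕ} (m : Fin (suc k) → ℕ) where
  open ProductGroup m using (Elem)
  open Automorphisms m
  module Tail = Automorphisms (m ∘ suc)

  extend : (Vector ℤ k → Vector ℤ k) → Elem → Elem
  extend φ x zero    = x zero
  extend φ x (suc i) = φ (tail x) i

  extend-invertible : ∀ {φ} → Tail.Invertible φ → Invertible (extend φ)
  extend-invertible {φ} I = record
    { inverse           = extend I.inverse
    ; congruent         = λ { x≋y zero → x≋y zero ; x≋y (suc i) → I.congruent (x≋y ∘ suc) i }
    ; inverse-congruent = λ { x≋y zero → x≋y zero ; x≋y (suc i) → I.inverse-congruent (x≋y ∘ suc) i }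
    ; additive          = λ { x y zero → mod-refl ; x y (suc i) → I.additive (tail x) (tail y) i }
    ; right-inverse     = λ { x zero → mod-refl ; x (suc i) → I.right-inverse (tail x) i }
    ; left-inverse      = λ { x zero → mod-refl ; x (suc i) → I.left-inverse (tail x) i }
    }
    where module I = Tail.Invertible I

  transvection : ℤ → Vector ℤ k → Elem → Elem
  transvection c w x zero    = x zero
  transvection c w x (suc i) = x (suc i) + c * x zero * w i

  -- c is admissible when mᵢ₊₁ ∣ c·m₀ for all i, i.e. x₀ ↦ c·x₀ is well
  -- defined from ℤ_{m₀} to every ℤ_{mᵢ₊₁}
  Admissible : ℤ → Set
  Admissible c = ∀ i → + m (suc i) ∣ c * + m zero

  transvection-cong : ∀ {c} w → Admissible c → ∀ {x y} → x ≋ y → transvection c w x ≋ transvection c w y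
  transvection-cong {c} w admissible x≋y zero    = x≋y zero
  transvection-cong {c} w admissible x≋y (suc i) =
    mod-+ (x≋y (suc i)) (mod-* (mod-weaken (admissible i) (mod-scale c (x≋y zero))) (mod-refl {a = w i}))

  transvection-cancel : ∀ c w x → transvection (- c) w (transvection c w x) ≋ x
  transvection-cancel c w x = ≋-reflexive λ
    { zero    → refl
    ; (suc i) → cancel (x (suc i)) c (x zero) (w i) }
    where
    cancel : ∀ y c x w → y + c * x * w + (- c) * x * w ≡ y
    cancel = solve-∀

  transvection-invertible : ∀ c w → Admissible c → Invertible (transvection c w)
  transvection-invertible c w admissible = record
    { inverse           = transvection (- c) w
    ; congruent         = transvection-cong w admissible
    ; inverse-congruent = transvection-cong w admissible⁻
    ; additive          = λ x y → ≋-reflexive λ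
        { zero    → refl
        ; (suc i) → distribute (x (suc i)) (y (suc i)) c (x zero) (y zero) (w i) }
    ; right-inverse     = λ x → subst (λ c' → transvection c' w (transvection (- c) w x) ≋ x)
                                  (ℤ.neg-involutive c) (transvection-cancel (- c) w x)
    ; left-inverse      = transvection-cancel c w
    }
    where
    admissible⁻ : Admissible (- c)
    admissible⁻ i = subst (+ m (suc i) ∣_) (ℤ.neg-distribˡ-* c (+ m zero)) (∣m⇒∣-m (admissible i))
    distribute : ∀ x y c x₀ y₀ w → (x + y) + c * (x₀ + y₀) * w ≡ (x + c * x₀ * w) + (y + c * y₀ * w)
    distribute = solve-∀

ones : ∀ {k} → Vector ℤ k
ones _ = + 1

weightedSum-homogeneous : ∀ {k} (d : Vector ℕ k) K (h h' : Vector ℤ k) →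
  (∀ i → h i ≡ K * h' i) → weightedSum d h ≡ K * weightedSum d h'
weightedSum-homogeneous {zero}  d K h h' h≡Kh' = sym (ℤ.*-zeroʳ K)
weightedSum-homogeneous {suc k} d K h h' h≡Kh' = begin
  + d zero * h zero + weightedSum (tail d) (tail h)
    ≡⟨ cong₂ (λ x y → + d zero * x + y) (h≡Kh' zero)
             (weightedSum-homogeneous (tail d) K (tail h) (tail h') (h≡Kh' ∘ suc)) ⟩
  + d zero * (K * h' zero) + K * weightedSum (tail d) (tail h')
    ≡⟨ factor (+ d zero) K (h' zero) (weightedSum (tail d) (tail h')) ⟩
  K * (+ d zero * h' zero + weightedSum (tail d) (tail h'))
    ∎
  where
  open ≡-Reasoning
  factor : ∀ d K h W → d * (K * h) + K * W ≡ K * (d * h + W)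
  factor = solve-∀

gcdAll∣n : ∀ n {k} (d : Vector ℕ k) → gcdAll n d ℕ.∣ n
gcdAll∣n n {zero}  d = ℕ.∣-refl
gcdAll∣n n {suc k} d = ℕ.∣-trans (gcd[m,n]∣n (d zero) _) (gcdAll∣n n (tail d))

gcdAll∣d : ∀ n {k} (d : Vector ℕ k) i → gcdAll n d ℕ.∣ d i
gcdAll∣d n {suc k} d zero    = gcd[m,n]∣m (d zero) _
gcdAll∣d n {suc k} d (suc i) = ℕ.∣-trans (gcd[m,n]∣n (d zero) _) (gcdAll∣d n (tail d) i)

module _ (n : ℕ) .{{_ : NonZero n}} where
  open Automorphisms using (Invertible)

  Solution : ∀ {k} → Vector ℕ k → Set
  Solution {k} d = Σ[ φ ∈ (Vector ℤ k → Vector ℤ k) ]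
    (Invertible (λ i → order n (d i)) φ × (weightedSum d (φ ones) ≡[ + n ] + gcdAll n d))

  solution-[] : (d : Vector ℕ 0) → Solution d
  solution-[] d = (λ x → x) , Automorphisms.id-invertible _ , 0≡n
    where
    0≡n : + 0 ≡[ + n ] + n
    0≡n = mod-intro (divides -1ℤ (trans (ℤ.+-identityˡ (- + n)) (sym (ℤ.-1*i≡-i (+ n)))))

  solution-∷ : ∀ {k} (d : Vector ℕ (suc k)) → Solution (tail d) → Solution d
  solution-∷ {k} d (φ' , φ'-invertible , φ'-solves) = φ , φ-invertible , φ-solves
    where
    m : Fin (suc k) → ℕ
    m i = order n (d i)
    open Extensions m
    open Automorphisms m using (∘-invertible; scale; scale-invertible)

    G P : ℕ
    G = gcdAll n (tail d)
    P = ℕ.quotient (gcdAll∣n n (tail d))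
    n≡PG : n ≡ P ℕ.* G
    n≡PG = ℕ.m∣n⇒n≡quotient*m (gcdAll∣n n (tail d))
    open Merge (merge-coefficients n (d zero) G P n≡PG)

    mᵢ∣P : ∀ i → + m (suc i) ∣ + P
    mᵢ∣P i = ∣ᵤ⇒∣ (order∣cofactor n≡PG (gcdAll∣d n (tail d) i))

    s : Vector ℤ (suc k)
    s zero    = u
    s (suc i) = v

    b : Vector ℤ k
    b = φ' ones
    φ : Vector ℤ (suc k) → Vector ℤ (suc k)
    φ = transvection c b ∘ scale s ∘ extend φ'

    φ-invertible : Invertible m φ
    φ-invertible =
      ∘-invertible (∘-invertible (extend-invertible φ'-invertible) (scale-invertible s s-units))
                   (transvection-invertible c b (λ i → ∣-trans (mᵢ∣P i) c-admits))
      where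
      s-units : ∀ i → Comaximal (s i) (+ m i)
      s-units zero    = u-unit
      s-units (suc i) = comaximal-divisor (mᵢ∣P i) v-unit

    φ-solves : weightedSum d (φ ones) ≡[ + n ] + gcdAll n d
    φ-solves = begin
      + d zero * (u * + 1) + weightedSum (tail d) (λ i → v * b i + c * (u * + 1) * b i)
        ≡⟨ cong₂ (λ x y → + d zero * x + y) (ℤ.*-identityʳ u)
                 (weightedSum-homogeneous (tail d) (v + c * u) _ b (λ i → collect v c u (b i))) ⟩
      + d zero * u + (v + c * u) * weightedSum (tail d) b
        ≈⟨ mod-+ (mod-refl {a = + d zero * u}) (mod-* (mod-refl {a = v + c * u}) φ'-solves) ⟩
      + d zero * u + (v + c * u) * + G
        ≈⟨ merges ⟩
      + gcd (d zero) G
        ∎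
      where
      open mod-Reasoning (+ n)
      collect : ∀ v c u b → v * b + c * (u * + 1) * b ≡ (v + c * u) * b
      collect = solve-∀

  solution : ∀ {k} (d : Vector ℕ k) → Solution d
  solution {zero}  d = solution-[] d
  solution {suc k} d = solution-∷ d (solution (tail d))

-- The theorem: the invertible map of `solution` is a group automorphism.
lemma2p7 : (n : ℕ) .{{_ : NonZero n}} (k : ℕ) (d : Vector ℕ k) →
    (∀ i → NonZero (d i)) →
    Σ[ φ ∈ (Vector ℤ k → Vector ℤ k) ]
    (IsAutomorphism (λ i → order n (d i)) φ ×
    ((+ n) ∣ᵤ (weightedSum d (φ (λ _ → + 1)) - (+ gcdAll n d))))
lemma2p7 n k d _ with solution n d
... | φ , φ-invertible , φ-solves =
  φ , Automorphisms.invertible⇒automorphism _ φ-invertible , ∣⇒∣ᵤ (mod-elim φ-solves)
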